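{- Let $c>0$, $k>0$ and $p\geq 0$ be integers, let $L=\operatorname{lcm}(1,2,\dots,c)$ and $k'=k+pL$. Then \[ I_{ck'}(1/k')=I_{ck}(1/k)+(k'-k)\left(c\sum_{j=1}^{c}\frac{\varphi(j)}{j}-\Phi(c)\right). \] Moreover, if $p\geq 1$, then \[ I_{ck'}(1/k')-I_{ck}(1/k)=I_{c(k'-k)}(1/(k'-k)) \quad\text{and}\quad \frac{I_{c(k'-k)}(1/(k'-k))}{k'-k}=c\sum_{j=1}^{c}\frac{\varphi(j)}{j}-\Phi(c). \]
   Context: For a positive integer $n$, the Farey sequence $F_n$ is the set of irreducible fractions $a/b$ with $0<a/b\leq 1$ and $1\leq b\leq n$ (the fraction $0/1$ is excluded). For $k>0$, $I_n(1/k)$ denotes the number of fractions $\alpha\in F_n$ with $\alpha<1/k$. $\varphi$ is Euler's totient function and $\Phi(m)=\sum_{j=1}^m\varphi(j)$. -}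

module Defs where

open import Data.Nat using (ℕ; zero; suc; _+_; _*_; _<_; _<?_)
open import Data.Nat.GCD using (gcd)
open import Data.Nat.LCM using (lcm)
open import Data.Nat.Properties using (_≟_)
open import Data.List using (List; []; _∷_; map; filter; length; concatMap; foldr)
open import Data.Nat.ListAction using (sum)
open import Data.Product using (_×_; _,_; proj₁; proj₂)
open import Relation.Nullary.Decidable using (_×-dec_)
open import Data.Integer using (+_)
open import Data.Rational using (ℚ; _/_; 0ℚ) renaming (_*_ to _*ℚ_)

range1 : ℕ → List ℕ
range1 zero    = []
range1 (suc n) = range1 n Data.List.++ (suc n ∷ [])

φ : ℕ → ℕ
φ n = length (filter (λ a → gcd a n ≟ 1) (range1 n))

Φ : ℕ → ℕ
Φ m = sum (map φ (range1 m))

lcmUpTo : ℕ → ℕ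
lcmUpTo c = foldr lcm 1 (range1 c)

pairs : ℕ → List (ℕ × ℕ)
pairs n = concatMap (λ b → map (λ a → (a , b)) (range1 b)) (range1 n)

-- Farey sequence F_n: irreducible a/b with 0 < a/b ≤ 1, 1 ≤ b ≤ n (each fraction once,
-- represented by its reduced pair)
farey : ℕ → List (ℕ × ℕ)
farey n = filter (λ ab → gcd (proj₁ ab) (proj₂ ab) ≟ 1) (pairs n)

-- I_n(1/k) = #{ a/b ∈ F_n : a/b < 1/k }; for b, k > 0, a/b < 1/k ⟺ a * k < b
I : ℕ → ℕ → ℕ
I n k = length (filter (λ ab → proj₁ ab * k <? proj₂ ab) (farey n))

sumPhiOverJ : ℕ → ℚ
sumPhiOverJ c = foldr (λ j acc → Data.Rational._+_ (term j) acc) 0ℚ (range1 c)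
  where
  term : ℕ → ℚ
  term zero    = 0ℚ
  term (suc j) = (+ φ (suc j)) / suc j

-- q / d for a rational q and a natural d; only ever used with d ≥ 1
-- (the value at d = 0 is an irrelevant convention)
divℕ : ℚ → ℕ → ℚ
divℕ q zero    = 0ℚ
divℕ q (suc d) = q *ℚ ((+ 1) / suc d)

{-# OPTIONS --safe #-}
-- Exchanging the order of summation, I_{ck}(1/k) = Σ_{a=1}^{c} #{b ∈ (ak, ck] : gcd(a,b) = 1}.
-- Coprimality to a is a-periodic in b and a ∣ L for every a ≤ c, so replacing k by k + pL
-- shifts the old window by apL, which changes nothing, and appends p(c − a)L consecutive
-- integers, of which p(c − a)(L/a)φ(a) are coprime to a. Summing over a, the increment is
-- pL·Σ_a (c − a)φ(a)/a = pL(c Σ_a φ(a)/a − Φ(c)).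
module Submission where

open import Defs

module Counting where

  open import Data.Nat
  open import Data.Nat.Properties
  open import Algebra.Properties.CommutativeSemigroup +-commutativeSemigroup
    using (interchange; xy∙z≈xz∙y)
  open import Data.Nat.Divisibility using (_∣_; divides; ∣-antisym; ∣-trans; ∣m∣n⇒∣m+n; ∣m+n∣m⇒∣n)
  open import Data.Nat.GCD using (gcd; gcd[m,n]∣m; gcd[m,n]∣n; gcd-greatest; gcd-comm)
  open import Data.Nat.LCM using (lcm; m∣lcm[m,n]; n∣lcm[m,n]; gcd*lcm)
  open import Data.Nat.ListAction using (sum)
  open import Data.Nat.ListAction.Properties using (sum-++)
  open import Data.Nat.Tactic.RingSolver using (solve-∀)
  open import Data.List using (List; []; _∷_; _++_; map; filter; length; concatMap; foldr)
  open import Data.List.Properties using (map-++; map-cong; map-∘)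
  open import Data.List.Membership.Propositional using (_∈_)
  open import Data.List.Membership.Propositional.Properties using (∈-++⁺ˡ; ∈-++⁺ʳ; ∈-++⁻)
  open import Data.List.Relation.Unary.Any using (here; there)
  open import Data.List.Relation.Unary.All using (All; []; _∷_)
  open import Data.List.Relation.Unary.All.Properties using (++⁺)
  open import Data.Product using (_×_; _,_; proj₁; proj₂; map₂)
  open import Data.Sum using (inj₁; inj₂)
  open import Function using (_∘_)
  open import Relation.Nullary using (Dec; yes; no; ¬_)
  open import Relation.Nullary.Negation using (contradiction)
  open import Relation.Unary using (Pred; Decidable)
  open import Relation.Binary.PropositionalEquality
  open ≡-Reasoning

  variable
    A B : Set

  𝟙 : {P : Set} → Dec P → ℕ
  𝟙 (yes _) = 1
  𝟙 (no _)  = 0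

  𝟙-yes : {P : Set} (P? : Dec P) → P → 𝟙 P? ≡ 1
  𝟙-yes (yes _) _  = refl
  𝟙-yes (no ¬p) p = contradiction p ¬p

  𝟙-no : {P : Set} (P? : Dec P) → ¬ P → 𝟙 P? ≡ 0
  𝟙-no (yes p) ¬p = contradiction p ¬p
  𝟙-no (no _)  _  = refl

  ∑ : List A → (A → ℕ) → ℕ
  ∑ xs f = sum (map f xs)

  ∑-++ : ∀ (xs ys : List A) f → ∑ (xs ++ ys) f ≡ ∑ xs f + ∑ ys f
  ∑-++ xs ys f = trans (cong sum (map-++ f xs ys)) (sum-++ (map f xs) (map f ys))

  ∑-cong : ∀ (xs : List A) {f g} → (∀ x → f x ≡ g x) → ∑ xs f ≡ ∑ xs g
  ∑-cong xs f≗g = cong sum (map-cong f≗g xs)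

  ∑-zero : ∀ (xs : List A) → ∑ xs (λ _ → 0) ≡ 0
  ∑-zero []       = refl
  ∑-zero (_ ∷ xs) = ∑-zero xs

  ∑-+ : ∀ (xs : List A) f g → ∑ xs (λ x → f x + g x) ≡ ∑ xs f + ∑ xs g
  ∑-+ []       f g = refl
  ∑-+ (x ∷ xs) f g = trans (cong (f x + g x +_) (∑-+ xs f g)) (interchange (f x) (g x) _ _)

  ∑-*ˡ : ∀ (xs : List A) m f → ∑ xs (λ x → m * f x) ≡ m * ∑ xs f
  ∑-*ˡ []       m f = sym (*-zeroʳ m)
  ∑-*ˡ (x ∷ xs) m f = trans (cong (m * f x +_) (∑-*ˡ xs m f)) (sym (*-distribˡ-+ m (f x) _))

  ∑-filter : {P : Pred A _} (P? : Decidable P) (xs : List A) (f : A → ℕ) →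
             ∑ (filter P? xs) f ≡ ∑ xs (λ x → 𝟙 (P? x) * f x)
  ∑-filter P? []       f = refl
  ∑-filter P? (x ∷ xs) f with P? x
  ... | yes _ = cong₂ _+_ (sym (*-identityˡ (f x))) (∑-filter P? xs f)
  ... | no _  = ∑-filter P? xs f

  length-filter : {P : Pred A _} (P? : Decidable P) (xs : List A) →
                  length (filter P? xs) ≡ ∑ xs (λ x → 𝟙 (P? x))
  length-filter P? []       = refl
  length-filter P? (x ∷ xs) with P? x
  ... | yes _ = cong suc (length-filter P? xs)
  ... | no _  = length-filter P? xs

  ∑-comm : (xs : List A) (ys : List B) (f : A → B → ℕ) →
           ∑ xs (λ x → ∑ ys (f x)) ≡ ∑ ys (λ y → ∑ xs (λ x → f x y))
  ∑-comm []       ys f = sym (∑-zero ys)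
  ∑-comm (x ∷ xs) ys f = trans (cong (∑ ys (f x) +_) (∑-comm xs ys f)) (sym (∑-+ ys (f x) _))

  ∑-concatMap : (F : A → List B) (xs : List A) (f : B → ℕ) →
                ∑ (concatMap F xs) f ≡ ∑ xs (λ x → ∑ (F x) f)
  ∑-concatMap F []       f = refl
  ∑-concatMap F (x ∷ xs) f = trans (∑-++ (F x) _ f) (cong (∑ (F x) f +_) (∑-concatMap F xs f))

  ∑-map : (g : A → B) (xs : List A) (f : B → ℕ) → ∑ (map g xs) f ≡ ∑ xs (f ∘ g)
  ∑-map g xs f = cong sum (sym (map-∘ xs))

  ∈-range1 : ∀ {a n} → 1 ≤ a → a ≤ n → a ∈ range1 n
  ∈-range1 {n = zero}  (s≤s _) ()
  ∈-range1 {n = suc n} 1≤a a≤1+n with m≤n⇒m<n∨m≡n a≤1+n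
  ... | inj₁ a<1+n = ∈-++⁺ˡ (∈-range1 1≤a (≤-pred a<1+n))
  ... | inj₂ refl  = ∈-++⁺ʳ (range1 n) (here refl)

  ∈-range1⁻ : ∀ {a} n → a ∈ range1 n → 1 ≤ a × a ≤ n
  ∈-range1⁻ (suc n) a∈ with ∈-++⁻ (range1 n) a∈
  ... | inj₁ a∈range1n  = map₂ m≤n⇒m≤1+n (∈-range1⁻ n a∈range1n)
  ... | inj₂ (here refl) = s≤s z≤n , ≤-refl

  range1-nonZero : ∀ n → All NonZero (range1 n)
  range1-nonZero zero    = []
  range1-nonZero (suc n) = ++⁺ (range1-nonZero n) (_ ∷ [])

  sumTo : ℕ → (ℕ → ℕ) → ℕ
  sumTo n = ∑ (range1 n)

  sumTo-suc : ∀ n f → sumTo (suc n) f ≡ sumTo n f + f (suc n)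
  sumTo-suc n f = trans (∑-++ (range1 n) _ f) (cong (sumTo n f +_) (+-identityʳ _))

  sumTo-cong : ∀ n {f g} → (∀ {a} → 1 ≤ a → a ≤ n → f a ≡ g a) → sumTo n f ≡ sumTo n g
  sumTo-cong zero    f≗g = refl
  sumTo-cong (suc n) {f} {g} f≗g = begin
    sumTo (suc n) f        ≡⟨ sumTo-suc n f ⟩
    sumTo n f + f (suc n)  ≡⟨ cong₂ _+_ (sumTo-cong n (λ 1≤a a≤n → f≗g 1≤a (m≤n⇒m≤1+n a≤n)))
                                       (f≗g (s≤s z≤n) ≤-refl) ⟩
    sumTo n g + g (suc n)  ≡⟨ sumTo-suc n g ⟨
    sumTo (suc n) g        ∎

  sumTo-vanishing : ∀ n {f} → (∀ {a} → 1 ≤ a → a ≤ n → f a ≡ 0) → sumTo n f ≡ 0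
  sumTo-vanishing n f≗0 = trans (sumTo-cong n f≗0) (∑-zero (range1 n))

  sumTo-split : ∀ m n f → sumTo (m + n) f ≡ sumTo m f + sumTo n (λ i → f (m + i))
  sumTo-split m zero    f = begin
    sumTo (m + 0) f  ≡⟨ cong (λ j → sumTo j f) (+-identityʳ m) ⟩
    sumTo m f        ≡⟨ +-identityʳ (sumTo m f) ⟨
    sumTo m f + 0    ∎
  sumTo-split m (suc n) f = begin
    sumTo (m + suc n) f                  ≡⟨ cong (λ j → sumTo j f) (+-suc m n) ⟩
    sumTo (suc (m + n)) f                ≡⟨ sumTo-suc (m + n) f ⟩
    sumTo (m + n) f + f (suc (m + n))    ≡⟨ cong₂ _+_ (sumTo-split m n f) (cong f (sym (+-suc m n))) ⟩
    sumTo m f + S n + f (m + suc n)      ≡⟨ +-assoc (sumTo m f) (S n) _ ⟩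
    sumTo m f + (S n + f (m + suc n))    ≡⟨ cong (sumTo m f +_) (sumTo-suc n (λ i → f (m + i))) ⟨
    sumTo m f + S (suc n)                ∎
    where
    S : ℕ → ℕ
    S j = sumTo j (λ i → f (m + i))

  sumTo-truncate : ∀ {c n f} → c ≤ n → (∀ {a} → c < a → f a ≡ 0) → sumTo n f ≡ sumTo c f
  sumTo-truncate {c} {n} {f} c≤n f≗0 = begin
    sumTo n f                                    ≡⟨ cong (λ m → sumTo m f) (m+[n∸m]≡n c≤n) ⟨
    sumTo (c + (n ∸ c)) f                        ≡⟨ sumTo-split c (n ∸ c) f ⟩
    sumTo c f + sumTo (n ∸ c) (λ i → f (c + i))  ≡⟨ cong (sumTo c f +_) tail≡0 ⟩
    sumTo c f + 0                                ≡⟨ +-identityʳ _ ⟩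
    sumTo c f                                    ∎
    where
    tail≡0 : sumTo (n ∸ c) (λ i → f (c + i)) ≡ 0
    tail≡0 = sumTo-vanishing (n ∸ c) (λ 1≤i _ → f≗0 (m<m+n c 1≤i))

  sumTo-above-empty : ∀ x n (f : ℕ → ℕ) → n ≤ x → sumTo n (λ b → f b * 𝟙 (x <? b)) ≡ 0
  sumTo-above-empty x n f n≤x = sumTo-vanishing n (λ {b} _ b≤n →
    trans (cong (f b *_) (𝟙-no (x <? b) (≤⇒≯ (≤-trans b≤n n≤x)))) (*-zeroʳ (f b)))

  sumTo-above : ∀ x d (f : ℕ → ℕ) →
                sumTo (x + d) (λ b → f b * 𝟙 (x <? b)) ≡ sumTo d (λ i → f (x + i))
  sumTo-above x d f = begin
    sumTo (x + d) (λ b → f b * 𝟙 (x <? b))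
      ≡⟨ sumTo-split x d (λ b → f b * 𝟙 (x <? b)) ⟩
    sumTo x (λ b → f b * 𝟙 (x <? b)) + sumTo d (λ i → f (x + i) * 𝟙 (x <? x + i))
      ≡⟨ cong₂ _+_ (sumTo-above-empty x x f ≤-refl) (sumTo-cong d above) ⟩
    sumTo d (λ i → f (x + i))
      ∎
    where
    above : ∀ {i} → 1 ≤ i → i ≤ d → f (x + i) * 𝟙 (x <? x + i) ≡ f (x + i)
    above {i} 1≤i _ = trans (cong (f (x + i) *_) (𝟙-yes (x <? x + i) (m<m+n x 1≤i))) (*-identityʳ _)

  Periodic : ℕ → (ℕ → ℕ) → Set
  Periodic d f = ∀ i → f (i + d) ≡ f i

  periodic-translate : ∀ {d f} → Periodic d f → ∀ x → Periodic d (λ i → f (x + i))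
  periodic-translate {d} {f} per x i = trans (cong f (sym (+-assoc x i d))) (per (x + i))

  periodic-multiple : ∀ {d f} → Periodic d f → ∀ t i → f (i + t * d) ≡ f i
  periodic-multiple {d} {f} per zero    i = cong f (+-identityʳ i)
  periodic-multiple {d} {f} per (suc t) i =
    trans (cong f (sym (+-assoc i d (t * d)))) (trans (periodic-multiple per t (i + d)) (per i))

  sumTo-rotate : ∀ {d g} → Periodic d g → sumTo d (g ∘ suc) ≡ sumTo d g
  sumTo-rotate {d} {g} per = +-cancelˡ-≡ (g 1) _ _ (begin
    g 1 + sumTo d (g ∘ suc)        ≡⟨ cong (_+ sumTo d (g ∘ suc)) (+-identityʳ (g 1)) ⟨
    sumTo 1 g + sumTo d (g ∘ suc)  ≡⟨ sumTo-split 1 d g ⟨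
    sumTo (suc d) g                ≡⟨ sumTo-suc d g ⟩
    sumTo d g + g (suc d)          ≡⟨ cong (sumTo d g +_) (per 1) ⟩
    sumTo d g + g 1                ≡⟨ +-comm (sumTo d g) (g 1) ⟩
    g 1 + sumTo d g                ∎)

  sumTo-periodic-window : ∀ {d f} → Periodic d f → ∀ x → sumTo d (λ i → f (x + i)) ≡ sumTo d f
  sumTo-periodic-window         per zero    = refl
  sumTo-periodic-window {d} {f} per (suc x) = begin
    sumTo d (λ i → f (suc x + i))  ≡⟨ ∑-cong (range1 d) (λ i → cong f (sym (+-suc x i))) ⟩
    sumTo d (λ i → f (x + suc i))  ≡⟨ sumTo-rotate (periodic-translate per x) ⟩
    sumTo d (λ i → f (x + i))      ≡⟨ sumTo-periodic-window per x ⟩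
    sumTo d f                      ∎

  sumTo-periodic : ∀ {d f} → Periodic d f → ∀ t x → sumTo (t * d) (λ i → f (x + i)) ≡ t * sumTo d f
  sumTo-periodic         per zero    x = refl
  sumTo-periodic {d} {f} per (suc t) x = begin
    sumTo (d + t * d) (λ i → f (x + i))
      ≡⟨ sumTo-split d (t * d) _ ⟩
    sumTo d (λ i → f (x + i)) + sumTo (t * d) (λ i → f (x + (d + i)))
      ≡⟨ cong₂ _+_ (sumTo-periodic-window per x)
                   (∑-cong (range1 (t * d)) (λ i → cong f (sym (+-assoc x d i)))) ⟩
    sumTo d f + sumTo (t * d) (λ i → f (x + d + i))
      ≡⟨ cong (sumTo d f +_) (sumTo-periodic per t (x + d)) ⟩
    sumTo d f + t * sumTo d f
      ∎

  gcd[m,n+m]≡gcd[m,n] : ∀ m n → gcd m (n + m) ≡ gcd m n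
  gcd[m,n+m]≡gcd[m,n] m n = ∣-antisym
    (gcd-greatest (gcd[m,n]∣m m (n + m)) (∣m+n∣m⇒∣n g∣m+n (gcd[m,n]∣m m (n + m))))
    (gcd-greatest (gcd[m,n]∣m m n) (∣m∣n⇒∣m+n (gcd[m,n]∣n m n) (gcd[m,n]∣m m n)))
    where
    g∣m+n : gcd m (n + m) ∣ m + n
    g∣m+n = subst (gcd m (n + m) ∣_) (+-comm n m) (gcd[m,n]∣n m (n + m))

  𝟙coprime : ℕ → ℕ → ℕ
  𝟙coprime a b = 𝟙 (gcd a b ≟ 1)

  𝟙coprime-periodic : ∀ a → Periodic a (𝟙coprime a)
  𝟙coprime-periodic a b = cong (λ g → 𝟙 (g ≟ 1)) (gcd[m,n+m]≡gcd[m,n] a b)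

  countCoprime : ℕ → ℕ → ℕ → ℕ
  countCoprime a x m = sumTo m (λ i → 𝟙coprime a (x + i))

  φ≡countCoprime : ∀ a → φ a ≡ countCoprime a 0 a
  φ≡countCoprime a = trans (length-filter (λ b → gcd b a ≟ 1) (range1 a))
                           (∑-cong (range1 a) (λ b → cong (λ g → 𝟙 (g ≟ 1)) (gcd-comm b a)))

  countCoprime-split : ∀ a x m n →
                       countCoprime a x (m + n) ≡ countCoprime a x m + countCoprime a (x + m) n
  countCoprime-split a x m n = trans (sumTo-split m n _)
    (cong (countCoprime a x m +_) (∑-cong (range1 n) (λ i → cong (𝟙coprime a) (sym (+-assoc x m i)))))

  countCoprime-shift : ∀ a x t m → countCoprime a (x + t * a) m ≡ countCoprime a x m
  countCoprime-shift a x t m = ∑-cong (range1 m) λ i →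
    trans (cong (𝟙coprime a) (xy∙z≈xz∙y x (t * a) i)) (periodic-multiple (𝟙coprime-periodic a) t (x + i))

  countCoprime-multiple : ∀ a x t → countCoprime a x (t * a) ≡ t * φ a
  countCoprime-multiple a x t =
    trans (sumTo-periodic (𝟙coprime-periodic a) t x) (cong (t *_) (sym (φ≡countCoprime a)))

  ∈⇒∣foldr-lcm : ∀ {x xs} e → x ∈ xs → x ∣ foldr lcm e xs
  ∈⇒∣foldr-lcm {x}          e (here refl)  = m∣lcm[m,n] x _
  ∈⇒∣foldr-lcm {xs = y ∷ _} e (there x∈xs) = ∣-trans (∈⇒∣foldr-lcm e x∈xs) (n∣lcm[m,n] y _)

  lcm≢0 : ∀ m n .{{_ : NonZero m}} .{{_ : NonZero n}} → NonZero (lcm m n)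
  lcm≢0 m n = m*n≢0⇒n≢0 (gcd m n) {{subst NonZero (sym (gcd*lcm m n)) (m*n≢0 m n)}}

  foldr-lcm≢0 : ∀ {e xs} {{_ : NonZero e}} → All NonZero xs → NonZero (foldr lcm e xs)
  foldr-lcm≢0 {{e≢0}} []                  = e≢0
  foldr-lcm≢0 {xs = x ∷ _} (x≢0 ∷ xs≢0) = lcm≢0 x _ {{x≢0}} {{foldr-lcm≢0 xs≢0}}

  ∣lcmUpTo : ∀ {a c} → 1 ≤ a → a ≤ c → a ∣ lcmUpTo c
  ∣lcmUpTo 1≤a a≤c = ∈⇒∣foldr-lcm 1 (∈-range1 1≤a a≤c)

  lcmUpTo>0 : ∀ c → 0 < lcmUpTo c
  lcmUpTo>0 c = >-nonZero⁻¹ (lcmUpTo c) {{foldr-lcm≢0 (range1-nonZero c)}}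

  I-as-double-sum : ∀ n k → I n k ≡ sumTo n (λ b → sumTo b (λ a → 𝟙coprime a b * 𝟙 (a * k <? b)))
  I-as-double-sum n k = begin
    I n k
      ≡⟨ length-filter _ (farey n) ⟩
    ∑ (farey n) (λ ab → 𝟙 (proj₁ ab * k <? proj₂ ab))
      ≡⟨ ∑-filter _ (pairs n) _ ⟩
    ∑ (pairs n) term
      ≡⟨ ∑-concatMap (λ b → map (_, b) (range1 b)) (range1 n) term ⟩
    sumTo n (λ b → ∑ (map (_, b) (range1 b)) term)
      ≡⟨ ∑-cong (range1 n) (λ b → ∑-map (_, b) (range1 b) term) ⟩
    sumTo n (λ b → sumTo b (λ a → 𝟙coprime a b * 𝟙 (a * k <? b)))
      ∎
    where
    term : ℕ × ℕ → ℕ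
    term (a , b) = 𝟙coprime a b * 𝟙 (a * k <? b)

  coprimeCountSum : ℕ → ℕ → ℕ
  coprimeCountSum c k = sumTo c (λ a → countCoprime a (a * k) ((c ∸ a) * k))

  I≡coprimeCountSum : ∀ c k → 1 ≤ k → I (c * k) k ≡ coprimeCountSum c k
  I≡coprimeCountSum c k 1≤k = begin
    I n k                                  ≡⟨ I-as-double-sum n k ⟩
    sumTo n (λ b → sumTo b (λ a → F a b))  ≡⟨ sumTo-cong n (λ _ b≤n → sumTo-extend b≤n) ⟩
    sumTo n (λ b → sumTo n (λ a → F a b))  ≡⟨ ∑-comm (range1 n) (range1 n) (λ b a → F a b) ⟩
    sumTo n (λ a → sumTo n (F a))          ≡⟨ sumTo-truncate c≤n sum-F[>c]≡0 ⟩
    sumTo c (λ a → sumTo n (F a))          ≡⟨ sumTo-cong c (λ _ a≤c → window a≤c) ⟩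
    coprimeCountSum c k                    ∎
    where
    n : ℕ
    n = c * k
    instance
      k≢0 : NonZero k
      k≢0 = >-nonZero 1≤k
    F : ℕ → ℕ → ℕ
    F a b = 𝟙coprime a b * 𝟙 (a * k <? b)
    c≤n : c ≤ n
    c≤n = m≤m*n c k
    F[>b]≡0 : ∀ {a b} → b < a → F a b ≡ 0
    F[>b]≡0 {a} {b} b<a =
      trans (cong (𝟙coprime a b *_) (𝟙-no (a * k <? b) b≯ak)) (*-zeroʳ (𝟙coprime a b))
      where
      b≯ak : ¬ (a * k < b)
      b≯ak = <-asym (<-≤-trans b<a (m≤m*n a k))
    sumTo-extend : ∀ {b} → b ≤ n → sumTo b (λ a → F a b) ≡ sumTo n (λ a → F a b)
    sumTo-extend b≤n = sym (sumTo-truncate b≤n F[>b]≡0)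
    sum-F[>c]≡0 : ∀ {a} → c < a → sumTo n (F a) ≡ 0
    sum-F[>c]≡0 {a} c<a = sumTo-above-empty (a * k) n (𝟙coprime a) (*-monoˡ-≤ k (<⇒≤ c<a))
    window : ∀ {a} → a ≤ c → sumTo n (F a) ≡ countCoprime a (a * k) ((c ∸ a) * k)
    window {a} a≤c = begin
      sumTo (c * k) (F a)                   ≡⟨ cong (λ m → sumTo (m * k) (F a)) (m+[n∸m]≡n a≤c) ⟨
      sumTo ((a + (c ∸ a)) * k) (F a)       ≡⟨ cong (λ m → sumTo m (F a)) (*-distribʳ-+ k a (c ∸ a)) ⟩
      sumTo (a * k + (c ∸ a) * k) (F a)     ≡⟨ sumTo-above (a * k) ((c ∸ a) * k) (𝟙coprime a) ⟩
      countCoprime a (a * k) ((c ∸ a) * k)  ∎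

  countCoprime-period-shift : ∀ {a L} c k p → a ∣ L →
    countCoprime a (a * (k + p * L)) ((c ∸ a) * (k + p * L))
      ≡ countCoprime a (a * k) ((c ∸ a) * k) + p * ((c ∸ a) * countCoprime a 0 L)
  countCoprime-period-shift {a} c k p (divides q refl) = begin
    countCoprime a (a * (k + p * (q * a))) (u * (k + p * (q * a)))
      ≡⟨ cong₂ (countCoprime a) (expand a k p q a) (expand u k p q a) ⟩
    countCoprime a (x + a * p * q * a) (u * k + u * p * q * a)
      ≡⟨ countCoprime-split a _ (u * k) (u * p * q * a) ⟩
    countCoprime a (x + a * p * q * a) (u * k) + countCoprime a _ (u * p * q * a)
      ≡⟨ cong₂ _+_ (countCoprime-shift a x (a * p * q) (u * k)) (countCoprime-multiple a _ (u * p * q)) ⟩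
    countCoprime a x (u * k) + u * p * q * φ a
      ≡⟨ cong (countCoprime a x (u * k) +_) (regroup u p q (φ a)) ⟩
    countCoprime a x (u * k) + p * (u * (q * φ a))
      ≡⟨ cong (λ z → countCoprime a x (u * k) + p * (u * z)) (countCoprime-multiple a 0 q) ⟨
    countCoprime a x (u * k) + p * (u * countCoprime a 0 (q * a))
      ∎
    where
    u x : ℕ
    u = c ∸ a
    x = a * k
    expand : ∀ y k p q a → y * (k + p * (q * a)) ≡ y * k + y * p * q * a
    expand = solve-∀
    regroup : ∀ u p q f → u * p * q * f ≡ p * (u * (q * f))
    regroup = solve-∀

  periodIncrement : ℕ → ℕ
  periodIncrement c = sumTo c (λ a → (c ∸ a) * countCoprime a 0 (lcmUpTo c))

  coprimeCountSum-shift : ∀ c k p →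
    coprimeCountSum c (k + p * lcmUpTo c) ≡ coprimeCountSum c k + p * periodIncrement c
  coprimeCountSum-shift c k p = begin
    coprimeCountSum c (k + p * L)
      ≡⟨ sumTo-cong c (λ 1≤a a≤c → countCoprime-period-shift c k p (∣lcmUpTo 1≤a a≤c)) ⟩
    sumTo c (λ a → countCoprime a (a * k) ((c ∸ a) * k) + p * ((c ∸ a) * countCoprime a 0 L))
      ≡⟨ ∑-+ (range1 c) _ _ ⟩
    coprimeCountSum c k + sumTo c (λ a → p * ((c ∸ a) * countCoprime a 0 L))
      ≡⟨ cong (coprimeCountSum c k +_) (∑-*ˡ (range1 c) p _) ⟩
    coprimeCountSum c k + p * periodIncrement c
      ∎
    where
    L : ℕ
    L = lcmUpTo c

  coprimeCountSum-zero : ∀ c → coprimeCountSum c 0 ≡ 0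
  coprimeCountSum-zero c = sumTo-vanishing c (λ {a} _ _ → cong (countCoprime a (a * 0)) (*-zeroʳ (c ∸ a)))

  I-shift : ∀ c k p → 1 ≤ k →
    I (c * (k + p * lcmUpTo c)) (k + p * lcmUpTo c) ≡ I (c * k) k + p * periodIncrement c
  I-shift c k p 1≤k = begin
    I (c * (k + p * L)) (k + p * L)      ≡⟨ I≡coprimeCountSum c _ (≤-trans 1≤k (m≤m+n k _)) ⟩
    coprimeCountSum c (k + p * L)        ≡⟨ coprimeCountSum-shift c k p ⟩
    coprimeCountSum c k + p * Δ          ≡⟨ cong (_+ p * Δ) (I≡coprimeCountSum c k 1≤k) ⟨
    I (c * k) k + p * Δ                  ∎
    where
    L Δ : ℕ
    L = lcmUpTo c
    Δ = periodIncrement c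

  I-period : ∀ c p → 1 ≤ p → I (c * (p * lcmUpTo c)) (p * lcmUpTo c) ≡ p * periodIncrement c
  I-period c p 1≤p = begin
    I (c * (p * L)) (p * L)        ≡⟨ I≡coprimeCountSum c _ (*-mono-≤ 1≤p (lcmUpTo>0 c)) ⟩
    coprimeCountSum c (0 + p * L)  ≡⟨ coprimeCountSum-shift c 0 p ⟩
    coprimeCountSum c 0 + p * Δ    ≡⟨ cong (_+ p * Δ) (coprimeCountSum-zero c) ⟩
    p * Δ                          ∎
    where
    L Δ : ℕ
    L = lcmUpTo c
    Δ = periodIncrement c

module Slope where

  open Counting using (∑; ∈-range1⁻; countCoprime; countCoprime-multiple; periodIncrement; ∣lcmUpTo)
  open import Data.Nat as ℕ using (ℕ; zero; suc; _∸_; z≤n; s≤s)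
  import Data.Nat.Properties as ℕ
  open import Data.Nat.Divisibility using (_∣_; divides)
  open import Data.Integer as ℤ using (+_)
  open import Data.Integer.Properties using (pos-+; pos-*)
  import Data.Integer.Tactic.RingSolver as ℤ-Solver
  open import Data.Rational
  open import Data.Rational.Properties
  import Data.Rational.Unnormalised as ℚᵘ
  import Data.Rational.Unnormalised.Properties as ℚᵘ
  open import Data.Rational.Solver using (module +-*-Solver)
  open import Data.List using (List; foldr; _∷_; [])
  open import Data.List.Properties using (foldr-cong)
  open import Data.List.Membership.Propositional using (_∈_)
  open import Data.List.Relation.Unary.Any using (here; there)
  open import Data.Product using (_,_)
  open import Function using (_∘_)
  open import Relation.Binary.PropositionalEquality

  fromℕ : ℕ → ℚ
  fromℕ m = + m / 1

  toℚᵘ-fromℕ : ∀ m → toℚᵘ (fromℕ m) ℚᵘ.≃ ℚᵘ.mkℚᵘ (+ m) 0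
  toℚᵘ-fromℕ m = toℚᵘ-fromℚᵘ (ℚᵘ.mkℚᵘ (+ m) 0)

  fromℕ-+ : ∀ m n → fromℕ (m ℕ.+ n) ≡ fromℕ m + fromℕ n
  fromℕ-+ m n = toℚᵘ-injective (begin
    toℚᵘ (fromℕ (m ℕ.+ n))
      ≈⟨ toℚᵘ-fromℕ (m ℕ.+ n) ⟩
    ℚᵘ.mkℚᵘ (+ (m ℕ.+ n)) 0
      ≈⟨ ℚᵘ.*≡* (trans (cong (ℤ._* + 1) (pos-+ m n)) (regroup (+ m) (+ n))) ⟩
    ℚᵘ.mkℚᵘ (+ m) 0 ℚᵘ.+ ℚᵘ.mkℚᵘ (+ n) 0
      ≈⟨ ℚᵘ.+-cong (toℚᵘ-fromℕ m) (toℚᵘ-fromℕ n) ⟨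
    toℚᵘ (fromℕ m) ℚᵘ.+ toℚᵘ (fromℕ n)
      ≈⟨ toℚᵘ-homo-+ (fromℕ m) (fromℕ n) ⟨
    toℚᵘ (fromℕ m + fromℕ n)
      ∎)
    where
    open ℚᵘ.≃-Reasoning
    regroup : ∀ x y → (x ℤ.+ y) ℤ.* + 1 ≡ (x ℤ.* + 1 ℤ.+ y ℤ.* + 1) ℤ.* + 1
    regroup = ℤ-Solver.solve-∀

  fromℕ-* : ∀ m n → fromℕ (m ℕ.* n) ≡ fromℕ m * fromℕ n
  fromℕ-* m n = toℚᵘ-injective (begin
    toℚᵘ (fromℕ (m ℕ.* n))
      ≈⟨ toℚᵘ-fromℕ (m ℕ.* n) ⟩
    ℚᵘ.mkℚᵘ (+ (m ℕ.* n)) 0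
      ≈⟨ ℚᵘ.*≡* (cong (ℤ._* + 1) (pos-* m n)) ⟩
    ℚᵘ.mkℚᵘ (+ m) 0 ℚᵘ.* ℚᵘ.mkℚᵘ (+ n) 0
      ≈⟨ ℚᵘ.*-cong (toℚᵘ-fromℕ m) (toℚᵘ-fromℕ n) ⟨
    toℚᵘ (fromℕ m) ℚᵘ.* toℚᵘ (fromℕ n)
      ≈⟨ toℚᵘ-homo-* (fromℕ m) (fromℕ n) ⟨
    toℚᵘ (fromℕ m * fromℕ n)
      ∎)
    where open ℚᵘ.≃-Reasoning

  fromℕ-*-/ : ∀ m d → fromℕ (suc d) * (+ m / suc d) ≡ fromℕ m
  fromℕ-*-/ m d = toℚᵘ-injective (begin
    toℚᵘ (fromℕ (suc d) * (+ m / suc d))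
      ≈⟨ toℚᵘ-homo-* (fromℕ (suc d)) (+ m / suc d) ⟩
    toℚᵘ (fromℕ (suc d)) ℚᵘ.* toℚᵘ (+ m / suc d)
      ≈⟨ ℚᵘ.*-cong (toℚᵘ-fromℕ (suc d)) (toℚᵘ-fromℚᵘ (ℚᵘ.mkℚᵘ (+ m) d)) ⟩
    ℚᵘ.mkℚᵘ (+ suc d) 0 ℚᵘ.* ℚᵘ.mkℚᵘ (+ m) d
      ≈⟨ ℚᵘ.*≡* (trans (swap (+ suc d) (+ m)) (cong (λ n → + m ℤ.* + suc n) (sym (ℕ.+-identityʳ d))))
       ⟩
    ℚᵘ.mkℚᵘ (+ m) 0
      ≈⟨ toℚᵘ-fromℕ m ⟨
    toℚᵘ (fromℕ m)
      ∎)
    where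
    open ℚᵘ.≃-Reasoning
    swap : ∀ x y → (x ℤ.* y) ℤ.* + 1 ≡ y ℤ.* x
    swap = ℤ-Solver.solve-∀

  fromℕ-∸ : ∀ {m n} → n ℕ.≤ m → fromℕ (m ∸ n) ≡ fromℕ m - fromℕ n
  fromℕ-∸ {m} {n} n≤m = begin
    fromℕ (m ∸ n)                      ≡⟨ +-cancel (fromℕ (m ∸ n)) (fromℕ n) ⟨
    fromℕ (m ∸ n) + fromℕ n - fromℕ n  ≡⟨ cong (_- fromℕ n) (fromℕ-+ (m ∸ n) n) ⟨
    fromℕ (m ∸ n ℕ.+ n) - fromℕ n      ≡⟨ cong (λ k → fromℕ k - fromℕ n) (ℕ.m∸n+n≡m n≤m) ⟩
    fromℕ m - fromℕ n                  ∎
    where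
    open ≡-Reasoning
    open +-*-Solver
    +-cancel : ∀ x y → x + y - y ≡ x
    +-cancel = solve 2 (λ x y → x :+ y :- y := x) refl

  divℕ-cancelˡ : ∀ n q → 0 ℕ.< n → divℕ (fromℕ n * q) n ≡ q
  divℕ-cancelˡ (suc d) q _ = begin
    fromℕ (suc d) * q * (+ 1 / suc d)    ≡⟨ cong (_* (+ 1 / suc d)) (*-comm (fromℕ (suc d)) q) ⟩
    q * fromℕ (suc d) * (+ 1 / suc d)    ≡⟨ *-assoc q (fromℕ (suc d)) (+ 1 / suc d) ⟩
    q * (fromℕ (suc d) * (+ 1 / suc d))  ≡⟨ cong (q *_) (fromℕ-*-/ 1 d) ⟩
    q * 1ℚ                               ≡⟨ *-identityʳ q ⟩
    q                                    ∎
    where open ≡-Reasoning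

  ∑ℚ : {A : Set} → List A → (A → ℚ) → ℚ
  ∑ℚ xs t = foldr (λ x acc → t x + acc) 0ℚ xs

  fromℕ-∑ : ∀ {A : Set} (xs : List A) f → fromℕ (∑ xs f) ≡ ∑ℚ xs (λ x → fromℕ (f x))
  fromℕ-∑ []       f = refl
  fromℕ-∑ (x ∷ xs) f = trans (fromℕ-+ (f x) (∑ xs f)) (cong (λ r → fromℕ (f x) + r) (fromℕ-∑ xs f))

  ∑ℚ-cong : ∀ {A : Set} (xs : List A) {s t} →
            (∀ {x} → x ∈ xs → s x ≡ t x) → ∑ℚ xs s ≡ ∑ℚ xs t
  ∑ℚ-cong []       s≗t = refl
  ∑ℚ-cong (x ∷ xs) s≗t = cong₂ _+_ (s≗t (here refl)) (∑ℚ-cong xs (s≗t ∘ there))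

  ∑ℚ-linear : ∀ {A : Set} (xs : List A) x y s u →
              ∑ℚ xs (λ a → x * (y * s a - u a)) ≡ x * (y * ∑ℚ xs s - ∑ℚ xs u)
  ∑ℚ-linear []       x y s u = sym (annihilate x y)
    where
    open +-*-Solver
    annihilate : ∀ x y → x * (y * 0ℚ - 0ℚ) ≡ 0ℚ
    annihilate = solve 2 (λ x y → x :* (y :* con 0ℚ :- con 0ℚ) := con 0ℚ) refl
  ∑ℚ-linear (a ∷ xs) x y s u =
    trans (cong (λ r → x * (y * s a - u a) + r) (∑ℚ-linear xs x y s u))
          (distrib x y (s a) (u a) (∑ℚ xs s) (∑ℚ xs u))
    where
    open +-*-Solver
    distrib : ∀ x y s u S U → x * (y * s - u) + x * (y * S - U) ≡ x * (y * (s + S) - (u + U))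
    distrib = solve 6 (λ x y s u S U →
      x :* (y :* s :- u) :+ x :* (y :* S :- U) := x :* (y :* (s :+ S) :- (u :+ U))) refl

  φ[n]/n : ℕ → ℚ
  φ[n]/n zero    = 0ℚ
  φ[n]/n (suc n) = + φ (suc n) / suc n

  sumPhiOverJ≡∑ℚ : ∀ c → sumPhiOverJ c ≡ ∑ℚ (range1 c) φ[n]/n
  sumPhiOverJ≡∑ℚ c = foldr-cong (λ { zero _ → refl ; (suc _) _ → refl }) refl (range1 c)

  slope : ℕ → ℚ
  slope c = fromℕ c * sumPhiOverJ c - fromℕ (Φ c)

  fromℕ-periodIncrement-term : ∀ {a c L} → 1 ℕ.≤ a → a ℕ.≤ c → a ∣ L →
    fromℕ ((c ∸ a) ℕ.* countCoprime a 0 L) ≡ fromℕ L * (fromℕ c * φ[n]/n a - fromℕ (φ a))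
  fromℕ-periodIncrement-term {suc j} {c} (s≤s z≤n) a≤c (divides q refl) = begin
    fromℕ ((c ∸ a) ℕ.* countCoprime a 0 (q ℕ.* a))
      ≡⟨ cong (λ n → fromℕ ((c ∸ a) ℕ.* n)) (countCoprime-multiple a 0 q) ⟩
    fromℕ ((c ∸ a) ℕ.* (q ℕ.* φ a))
      ≡⟨ trans (fromℕ-* (c ∸ a) _) (cong₂ _*_ (fromℕ-∸ a≤c) (fromℕ-* q (φ a))) ⟩
    (fromℕ c - fromℕ a) * (fromℕ q * fromℕ (φ a))
      ≡⟨ cong (λ x → (fromℕ c - fromℕ a) * (fromℕ q * x)) a*t≡φ ⟨
    (fromℕ c - fromℕ a) * (fromℕ q * (fromℕ a * t))
      ≡⟨ regroup (fromℕ c) (fromℕ a) (fromℕ q) t ⟩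
    fromℕ q * fromℕ a * (fromℕ c * t - fromℕ a * t)
      ≡⟨ cong₂ (λ x y → x * (fromℕ c * t - y)) (fromℕ-* q a) (sym a*t≡φ) ⟨
    fromℕ (q ℕ.* a) * (fromℕ c * t - fromℕ (φ a))
      ∎
    where
    open ≡-Reasoning
    open +-*-Solver
    a : ℕ
    a = suc j
    t : ℚ
    t = φ[n]/n a
    a*t≡φ : fromℕ a * t ≡ fromℕ (φ a)
    a*t≡φ = fromℕ-*-/ (φ a) j
    regroup : ∀ c a q t → (c - a) * (q * (a * t)) ≡ q * a * (c * t - a * t)
    regroup = solve 4 (λ c a q t → (c :- a) :* (q :* (a :* t)) := q :* a :* (c :* t :- a :* t)) refl

  fromℕ-periodIncrement : ∀ c → fromℕ (periodIncrement c) ≡ fromℕ (lcmUpTo c) * slope c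
  fromℕ-periodIncrement c = begin
    fromℕ (periodIncrement c)
      ≡⟨ fromℕ-∑ (range1 c) _ ⟩
    ∑ℚ (range1 c) (λ a → fromℕ ((c ∸ a) ℕ.* countCoprime a 0 L))
      ≡⟨ ∑ℚ-cong (range1 c) term ⟩
    ∑ℚ (range1 c) (λ a → fromℕ L * (fromℕ c * φ[n]/n a - fromℕ (φ a)))
      ≡⟨ ∑ℚ-linear (range1 c) (fromℕ L) (fromℕ c) φ[n]/n (λ a → fromℕ (φ a)) ⟩
    fromℕ L * (fromℕ c * ∑ℚ (range1 c) φ[n]/n - ∑ℚ (range1 c) (λ a → fromℕ (φ a)))
      ≡⟨ cong₂ (λ s u → fromℕ L * (fromℕ c * s - u)) (sumPhiOverJ≡∑ℚ c) (fromℕ-∑ (range1 c) φ) ⟨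
    fromℕ L * slope c
      ∎
    where
    open ≡-Reasoning
    L : ℕ
    L = lcmUpTo c
    term : ∀ {a} → a ∈ range1 c →
           fromℕ ((c ∸ a) ℕ.* countCoprime a 0 L) ≡ fromℕ L * (fromℕ c * φ[n]/n a - fromℕ (φ a))
    term a∈ with ∈-range1⁻ c a∈
    ... | 1≤a , a≤c = fromℕ-periodIncrement-term 1≤a a≤c (∣lcmUpTo 1≤a a≤c)

  fromℕ-*-periodIncrement : ∀ c p →
    fromℕ (p ℕ.* periodIncrement c) ≡ fromℕ (p ℕ.* lcmUpTo c) * slope c
  fromℕ-*-periodIncrement c p = begin
    fromℕ (p ℕ.* periodIncrement c)          ≡⟨ fromℕ-* p (periodIncrement c) ⟩
    fromℕ p * fromℕ (periodIncrement c)      ≡⟨ cong (fromℕ p *_) (fromℕ-periodIncrement c) ⟩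
    fromℕ p * (fromℕ (lcmUpTo c) * slope c)  ≡⟨ *-assoc (fromℕ p) _ (slope c) ⟨
    fromℕ p * fromℕ (lcmUpTo c) * slope c    ≡⟨ cong (_* slope c) (fromℕ-* p (lcmUpTo c)) ⟨
    fromℕ (p ℕ.* lcmUpTo c) * slope c        ∎
    where open ≡-Reasoning

open import Data.Nat using (ℕ; _<_; _∸_) renaming (_+_ to _+ℕ_; _*_ to _*ℕ_)
open import Data.Nat.Properties using (m+n∸m≡n; *-mono-≤)
open import Data.Integer using (+_)
open import Data.Rational using (ℚ; _+_; _-_; _*_; _/_)
open import Data.Product using (_×_; _,_)
open import Relation.Binary.PropositionalEquality using (_≡_; cong; sym; trans; subst; module ≡-Reasoning)
open Counting using (periodIncrement; I-shift; I-period; lcmUpTo>0)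
open Slope using (fromℕ; slope; fromℕ-+; fromℕ-*-periodIncrement; divℕ-cancelˡ)

corollary6 : (c k p : ℕ) → 0 < c → 0 < k →
    let L = lcmUpTo c
        k′ = k +ℕ p *ℕ L
        C = ((+ c) / 1) * sumPhiOverJ c - (+ Φ c) / 1
    in (((+ I (c *ℕ k′) k′) / 1) ≡ ((+ I (c *ℕ k) k) / 1) + ((+ (k′ ∸ k)) / 1) * C)
       × (1 Data.Nat.≤ p →
            (I (c *ℕ k′) k′ ∸ I (c *ℕ k) k ≡ I (c *ℕ (k′ ∸ k)) (k′ ∸ k))
            × (divℕ ((+ I (c *ℕ (k′ ∸ k)) (k′ ∸ k)) / 1) (k′ ∸ k) ≡ C))
corollary6 c k p _ 0<k = value , λ 1≤p → difference 1≤p , average 1≤p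
  where
  open ≡-Reasoning
  L k′ old Δ : ℕ
  L = lcmUpTo c
  k′ = k +ℕ p *ℕ L
  old = I (c *ℕ k) k
  Δ = periodIncrement c
  k′∸k≡pL : k′ ∸ k ≡ p *ℕ L
  k′∸k≡pL = m+n∸m≡n k (p *ℕ L)
  increment : fromℕ (p *ℕ Δ) ≡ fromℕ (k′ ∸ k) * slope c
  increment = trans (fromℕ-*-periodIncrement c p) (cong (λ d → fromℕ d * slope c) (sym k′∸k≡pL))
  period : 1 Data.Nat.≤ p → I (c *ℕ (k′ ∸ k)) (k′ ∸ k) ≡ p *ℕ Δ
  period 1≤p = trans (cong (λ d → I (c *ℕ d) d) k′∸k≡pL) (I-period c p 1≤p)
  value : fromℕ (I (c *ℕ k′) k′) ≡ fromℕ old + fromℕ (k′ ∸ k) * slope c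
  value = begin
    fromℕ (I (c *ℕ k′) k′)                ≡⟨ cong fromℕ (I-shift c k p 0<k) ⟩
    fromℕ (old +ℕ p *ℕ Δ)                 ≡⟨ fromℕ-+ old (p *ℕ Δ) ⟩
    fromℕ old + fromℕ (p *ℕ Δ)            ≡⟨ cong (λ r → fromℕ old + r) increment ⟩
    fromℕ old + fromℕ (k′ ∸ k) * slope c  ∎
  difference : 1 Data.Nat.≤ p → I (c *ℕ k′) k′ ∸ old ≡ I (c *ℕ (k′ ∸ k)) (k′ ∸ k)
  difference 1≤p = begin
    I (c *ℕ k′) k′ ∸ old           ≡⟨ cong (_∸ old) (I-shift c k p 0<k) ⟩
    old +ℕ p *ℕ Δ ∸ old            ≡⟨ m+n∸m≡n old (p *ℕ Δ) ⟩
    p *ℕ Δ                         ≡⟨ period 1≤p ⟨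
    I (c *ℕ (k′ ∸ k)) (k′ ∸ k)     ∎
  average : 1 Data.Nat.≤ p → divℕ (fromℕ (I (c *ℕ (k′ ∸ k)) (k′ ∸ k))) (k′ ∸ k) ≡ slope c
  average 1≤p = begin
    divℕ (fromℕ (I (c *ℕ (k′ ∸ k)) (k′ ∸ k))) (k′ ∸ k)
      ≡⟨ cong (λ x → divℕ (fromℕ x) (k′ ∸ k)) (period 1≤p) ⟩
    divℕ (fromℕ (p *ℕ Δ)) (k′ ∸ k)
      ≡⟨ cong (λ x → divℕ x (k′ ∸ k)) increment ⟩
    divℕ (fromℕ (k′ ∸ k) * slope c) (k′ ∸ k)
      ≡⟨ divℕ-cancelˡ (k′ ∸ k) (slope c) k′∸k>0 ⟩
    slope c
      ∎
    where
    k′∸k>0 : 0 < k′ ∸ k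
    k′∸k>0 = subst (0 <_) (sym k′∸k≡pL) (*-mono-≤ 1≤p (lcmUpTo>0 c))
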